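{- Let $\mathbf{N}$ denote the set of positive integers and $\mathbf{Q}$ the set of rational numbers. If $f:\mathbf{N} \rightarrow \mathbf{Q}$ is surjective, then for no positive integer $k$ is $f$ $k$-monotonic; that is, for every positive integer $k$ there do not exist subsets $X_1, \ldots, X_k \subseteq \mathbf{N}$ with $\mathbf{N} = X_1 \cup \cdots \cup X_k$ such that for each $i = 1, \ldots, k$ the restriction $f|X_i$ is monotonically increasing or monotonically decreasing.
   Context: A function $g: A \rightarrow B$ between ordered sets is monotonically increasing if $x \leq x'$ implies $g(x) \leq g(x')$, and monotonically decreasing if $x \leq x'$ implies $g(x) \geq g(x')$. The function $f$ is called $k$-monotonic if its domain is a union of $k$ subsets on each of which $f$ is monotonically increasing or monotonically decreasing. -}

module Defs where

open import Level using (0ℓ)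
open import Data.Nat using (ℕ; _≤_)
open import Data.Fin using (Fin)
open import Data.Rational using (ℚ) renaming (_≤_ to _≤ℚ_)
open import Data.Product using (Σ; _×_; ∃-syntax)
open import Data.Sum using (_⊎_)
open import Relation.Binary.PropositionalEquality using (_≡_)

-- The domain 𝐍 = positive integers is represented as the elements n : ℕ with 1 ≤ n.
Positive : ℕ → Set
Positive n = 1 ≤ n

Subset : Set₁
Subset = ℕ → Set

-- f : 𝐍 → ℚ (given as ℕ → ℚ, only values at positive n matter) is surjective onto ℚ.
SurjectiveOnto : (ℕ → ℚ) → Set
SurjectiveOnto f = ∀ (q : ℚ) → ∃[ n ] (Positive n × f n ≡ q)

MonoIncOn : (ℕ → ℚ) → Subset → Set
MonoIncOn f X = ∀ x x′ → Positive x → Positive x′ → X x → X x′ → x ≤ x′ → f x ≤ℚ f x′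

MonoDecOn : (ℕ → ℚ) → Subset → Set
MonoDecOn f X = ∀ x x′ → Positive x → Positive x′ → X x → X x′ → x ≤ x′ → f x′ ≤ℚ f x

KMonotonic : ℕ → (ℕ → ℚ) → Set₁
KMonotonic k f =
  Σ (Fin k → Subset) λ X →
      ((n : ℕ) → Positive n → Σ (Fin k) λ i → X i n)
    × ((i : Fin k) → MonoIncOn f (X i) ⊎ MonoDecOn f (X i))

{-# OPTIONS --safe #-}
module Submission where

-- Every open interval (a, b) of ℚ contains a value f n, and n lies in some piece X.
-- If f increases on X, the finitely many values f p with p < n leave a gap (c, f n)
-- inside (a, b) that f maps no element of X into: elements after n have values
-- ≥ f n and those before n miss the gap.  Decreasing pieces are dual.  So the other
-- pieces cover the preimage of a smaller interval, and discarding the pieces one at a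
-- time leaves a nonempty interval whose preimage is uncovered, although surjectivity
-- makes that preimage nonempty.

open import Defs
open import Data.Nat using (ℕ; _≤_; _≤?_; zero; suc)
open import Data.Nat.Properties using (≰⇒>)
open import Data.Rational using (ℚ; 1ℚ) renaming (_<_ to _<ℚ_; _≤_ to _≤ℚ_)
open import Data.Rational.Properties
  using (<-dense; <-irrefl; <-trans; <⇒≤; ≤-refl; ≤-trans; ≤-<-trans; <-≤-trans; _<?_; positive⁻¹)
open import Data.List using (List; []; _∷_; applyUpTo)
open import Data.List.Relation.Unary.All as All using (All; []; _∷_)
open import Data.List.Membership.Propositional.Properties using (∈-applyUpTo⁺)
open import Data.Fin using (Fin; punchIn; punchOut; _≟_)
open import Data.Fin.Properties using (punchIn-punchOut)
open import Data.Product using (_×_; _,_; ∃; ∃₂; ∃-syntax)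
open import Data.Sum using (_⊎_; inj₁; inj₂)
open import Data.Empty using (⊥-elim)
open import Function using (_∘_)
open import Relation.Nullary using (¬_; yes; no)
open import Relation.Binary.PropositionalEquality using (refl; sym; subst)

∃-punchIn : ∀ {m} {P : Fin (suc m) → Set} (j : Fin (suc m)) → ∃ P → ¬ P j → ∃ (P ∘ punchIn j)
∃-punchIn {P = P} j (i , pi) ¬pj with j ≟ i
... | yes refl = ⊥-elim (¬pj pi)
... | no j≢i   = punchOut j≢i , subst P (sym (punchIn-punchOut j≢i)) pi

gap-below : (xs : List ℚ) {a q : ℚ} → a <ℚ q →
            ∃[ c ] a ≤ℚ c × c <ℚ q × All (λ x → ¬ (c <ℚ x × x <ℚ q)) xs
gap-below []       a<q = _ , ≤-refl , a<q , []
gap-below (x ∷ xs) {q = q} a<q with gap-below xs a<q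
... | c , a≤c , c<q , gap with c <? x | x <? q
...   | yes c<x | yes x<q = x , ≤-trans a≤c (<⇒≤ c<x) , x<q , (λ (x<x , _) → <-irrefl refl x<x)
                              ∷ All.map (λ ¬c<y<q (x<y , y<q) → ¬c<y<q (<-trans c<x x<y , y<q)) gap
...   | no c≮x  | _       = c , a≤c , c<q , (λ (c<x , _) → c≮x c<x) ∷ gap
...   | yes _   | no x≮q  = c , a≤c , c<q , (λ (_ , x<q) → x≮q x<q) ∷ gap

gap-above : (xs : List ℚ) {q b : ℚ} → q <ℚ b →
            ∃[ d ] q <ℚ d × d ≤ℚ b × All (λ x → ¬ (q <ℚ x × x <ℚ d)) xs
gap-above []       q<b = _ , q<b , ≤-refl , []
gap-above (x ∷ xs) {q} q<b with gap-above xs q<b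
... | d , q<d , d≤b , gap with q <? x | x <? d
...   | yes q<x | yes x<d = x , q<x , ≤-trans (<⇒≤ x<d) d≤b , (λ (_ , x<x) → <-irrefl refl x<x)
                              ∷ All.map (λ ¬q<y<d (q<y , y<x) → ¬q<y<d (q<y , <-trans y<x x<d)) gap
...   | no q≮x  | _       = d , q<d , d≤b , (λ (q<x , _) → q≮x q<x) ∷ gap
...   | yes _   | no x≮d  = d , q<d , d≤b , (λ (_ , x<d) → x≮d x<d) ∷ gap

module _ (f : ℕ → ℚ) where

  Monotone : Subset → Set
  Monotone X = MonoIncOn f X ⊎ MonoDecOn f X

  ValuesAvoid : Subset → ℚ → ℚ → Set
  ValuesAvoid X c d = ∀ {n} → Positive n → X n → ¬ (c <ℚ f n × f n <ℚ d)

  Covers : ∀ {m} → (Fin m → Subset) → ℚ → ℚ → Set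
  Covers Y a b = ∀ {n} → Positive n → a <ℚ f n → f n <ℚ b → ∃[ i ] Y i n

  increasing⇒avoids-below : ∀ {X n a} → MonoIncOn f X → Positive n → X n → a <ℚ f n →
                            ∃[ c ] a ≤ℚ c × c <ℚ f n × ValuesAvoid X c (f n)
  increasing⇒avoids-below {X} {n} inc pn xn a<fn with gap-below (applyUpTo f n) a<fn
  ... | c , a≤c , c<fn , gap = c , a≤c , c<fn , avoid
    where
    avoid : ValuesAvoid X c (f n)
    avoid {n′} pn′ xn′ (c<fn′ , fn′<fn) with n ≤? n′
    ... | yes n≤n′ = <-irrefl refl (<-≤-trans fn′<fn (inc n n′ pn pn′ xn xn′ n≤n′))
    ... | no n≰n′  = All.lookup gap (∈-applyUpTo⁺ f (≰⇒> n≰n′)) (c<fn′ , fn′<fn)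

  decreasing⇒avoids-above : ∀ {X n b} → MonoDecOn f X → Positive n → X n → f n <ℚ b →
                            ∃[ d ] f n <ℚ d × d ≤ℚ b × ValuesAvoid X (f n) d
  decreasing⇒avoids-above {X} {n} dec pn xn fn<b with gap-above (applyUpTo f n) fn<b
  ... | d , fn<d , d≤b , gap = d , fn<d , d≤b , avoid
    where
    avoid : ValuesAvoid X (f n) d
    avoid {n′} pn′ xn′ (fn<fn′ , fn′<d) with n ≤? n′
    ... | yes n≤n′ = <-irrefl refl (<-≤-trans fn<fn′ (dec n n′ pn pn′ xn xn′ n≤n′))
    ... | no n≰n′  = All.lookup gap (∈-applyUpTo⁺ f (≰⇒> n≰n′)) (fn<fn′ , fn′<d)

  monotone⇒avoids-subinterval : ∀ {X n a b} → Monotone X → Positive n → X n → a <ℚ f n → f n <ℚ b →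
                                ∃₂ λ c d → a ≤ℚ c × c <ℚ d × d ≤ℚ b × ValuesAvoid X c d
  monotone⇒avoids-subinterval (inj₁ inc) pn xn a<fn fn<b
    with c , a≤c , c<fn , avoid ← increasing⇒avoids-below inc pn xn a<fn
    = c , _ , a≤c , c<fn , <⇒≤ fn<b , avoid
  monotone⇒avoids-subinterval (inj₂ dec) pn xn a<fn fn<b
    with d , fn<d , d≤b , avoid ← decreasing⇒avoids-above dec pn xn fn<b
    = _ , d , <⇒≤ a<fn , fn<d , d≤b , avoid

  Covers-restrict : ∀ {m} {Y : Fin m → Subset} {a b c d} → a ≤ℚ c → d ≤ℚ b → Covers Y a b → Covers Y c d
  Covers-restrict a≤c d≤b cov pn c<fn fn<d = cov pn (≤-<-trans a≤c c<fn) (<-≤-trans fn<d d≤b)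

  Covers-drop : ∀ {m} {Y : Fin (suc m) → Subset} {c d} j → ValuesAvoid (Y j) c d →
                Covers Y c d → Covers (Y ∘ punchIn j) c d
  Covers-drop j avoid cov pn c<fn fn<d =
    ∃-punchIn j (cov pn c<fn fn<d) (λ yjn → avoid pn yjn (c<fn , fn<d))

  module _ (surj : SurjectiveOnto f) where

    Covers⇒∃-piece : ∀ {m} {Y : Fin m → Subset} {a b} → a <ℚ b → Covers Y a b →
                     ∃₂ λ n i → Positive n × Y i n × a <ℚ f n × f n <ℚ b
    Covers⇒∃-piece a<b cov
      with q , a<q , q<b ← <-dense a<b
      with n , pn , refl ← surj q
      with i , yin ← cov pn a<q q<b
      = n , i , pn , yin , a<q , q<b

    ¬monotone-Covers : ∀ m (Y : Fin m → Subset) → (∀ i → Monotone (Y i)) →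
                       ∀ {a b} → a <ℚ b → ¬ Covers Y a b
    ¬monotone-Covers m Y mono a<b cov with Covers⇒∃-piece a<b cov
    ¬monotone-Covers zero Y mono a<b cov | _ , () , _
    ¬monotone-Covers (suc m) Y mono a<b cov | n , j , pn , yjn , a<fn , fn<b
      with c , d , a≤c , c<d , d≤b , avoid ← monotone⇒avoids-subinterval (mono j) pn yjn a<fn fn<b
      = ¬monotone-Covers m (Y ∘ punchIn j) (mono ∘ punchIn j) c<d
          (Covers-drop j avoid (Covers-restrict a≤c d≤b cov))

theorem2 : (f : ℕ → ℚ) → SurjectiveOnto f → (k : ℕ) → 1 ≤ k → ¬ KMonotonic k f
theorem2 f surj k _ (X , cover , mono) =
  ¬monotone-Covers f surj k X mono (positive⁻¹ 1ℚ) (λ pn _ _ → cover _ pn)
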